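{- There exists a projective $(126,8)$-arc $\mathfrak{k}$ in the projective Hjelmslev plane $\mathrm{PHG}(2,\mathbb{G}_{16})$, where $\mathbb{G}_{16}=\mathrm{GR}(16,4)$. Moreover, such an arc can be chosen so that it meets exactly $315$ lines in exactly $8$ points and the remaining $21$ lines in no point.
   Context: $\mathrm{GR}(16,4)=\mathbb{Z}_4[X]/(f)$ with $f\in\mathbb{Z}_4[X]$ monic of degree $2$ and irreducible modulo $2$ (e.g. $f=X^2+X+1$). The projective Hjelmslev plane $\mathrm{PHG}(2,R)$ has as points the free rank-$1$ submodules of $R^3$, as lines the free rank-$2$ submodules of $R^3$, and incidence given by set inclusion; for $R=\mathbb{G}_{16}$ it has $336$ points and $336$ lines. A set $\mathfrak{k}$ of $n$ points is a projective $(n,u)$-arc if some $u$ of its elements lie on a common line but no $u+1$ of its elements do. -}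

module Defs where

open import Data.Nat using (ℕ; _+_; _*_; _≤_)
open import Data.Nat.DivMod using (_mod_)
open import Data.Fin using (Fin; toℕ; zero; suc)
open import Data.Fin.Properties using (any?) renaming (_≟_ to _≟F_)
open import Data.Product using (_×_; _,_; ∃; ∃-syntax; proj₁; proj₂)
open import Data.Product.Properties using (≡-dec)
open import Data.List using (List; length; filter)
open import Data.List.Relation.Unary.All using (All)
open import Data.List.Relation.Unary.Any using (Any)
open import Data.List.Relation.Unary.AllPairs using (AllPairs)
open import Relation.Nullary using (Dec; ¬_)
open import Relation.Nullary.Decidable using (map′)
open import Relation.Binary.PropositionalEquality using (_≡_)
open import Relation.Binary.Definitions using (DecidableEquality)

Z4 : Set
Z4 = Fin 4

infixl 6 _+₄_
infixl 7 _*₄_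

_+₄_ : Z4 → Z4 → Z4
a +₄ b = (toℕ a + toℕ b) mod 4

_*₄_ : Z4 → Z4 → Z4
a *₄ b = (toℕ a * toℕ b) mod 4

-₄_ : Z4 → Z4
-₄ a = (3 * toℕ a) mod 4

-- The Galois ring G16 = GR(16,4) = ℤ₄[X]/(X² + X + 1).
-- An element (a , b) represents a + bX.  Since X² = -X - 1,
-- (a + bX)(c + dX) = (ac - bd) + (ad + bc - bd) X.

GR : Set
GR = Z4 × Z4

0R : GR
0R = (zero , zero)

infixl 6 _⊕_
infixl 7 _⊗_

_⊕_ : GR → GR → GR
(a , b) ⊕ (c , d) = (a +₄ c , b +₄ d)

_⊗_ : GR → GR → GR
(a , b) ⊗ (c , d) = (a *₄ c +₄ -₄ (b *₄ d) , a *₄ d +₄ b *₄ c +₄ -₄ (b *₄ d))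

_≟R_ : DecidableEquality GR
_≟R_ = ≡-dec _≟F_ _≟F_

V : Set
V = GR × GR × GR

0V : V
0V = (0R , 0R , 0R)

infixl 6 _⊕V_
infix 7 _•_

_⊕V_ : V → V → V
(x₁ , x₂ , x₃) ⊕V (y₁ , y₂ , y₃) = (x₁ ⊕ y₁ , x₂ ⊕ y₂ , x₃ ⊕ y₃)

_•_ : GR → V → V
r • (x₁ , x₂ , x₃) = (r ⊗ x₁ , r ⊗ x₂ , r ⊗ x₃)

_≟V_ : DecidableEquality V
_≟V_ = ≡-dec _≟R_ (≡-dec _≟R_ _≟R_)

InSpan1 : V → V → Set
InSpan1 x v = ∃[ a ] (a • v ≡ x)

InSpan2 : V → V → V → Set
InSpan2 x v₁ v₂ = ∃[ a ] ∃[ b ] (a • v₁ ⊕V b • v₂ ≡ x)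

-- Every free rank-1 submodule of R³ has this form, so the points of
-- PHG(2,R) are the submodules R v with v satisfying IsPointRep.
IsPointRep : V → Set
IsPointRep v = ∀ a → a • v ≡ 0V → a ≡ 0R

-- R v₁ + R v₂ is free of rank 2 with basis (v₁ , v₂).
-- Lines of PHG(2,R) are exactly such submodules.
IsLineRep : V × V → Set
IsLineRep (v₁ , v₂) = ∀ a b → a • v₁ ⊕V b • v₂ ≡ 0V → (a ≡ 0R × b ≡ 0R)

SamePoint : V → V → Set
SamePoint v w = InSpan1 v w × InSpan1 w v

SameLine : V × V → V × V → Set
SameLine (v₁ , v₂) (w₁ , w₂) =
  (InSpan2 w₁ v₁ v₂ × InSpan2 w₂ v₁ v₂) × (InSpan2 v₁ w₁ w₂ × InSpan2 v₂ w₁ w₂)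

Incident : V → V × V → Set
Incident v (v₁ , v₂) = InSpan2 v v₁ v₂

anyGR? : {P : GR → Set} → (∀ r → Dec (P r)) → Dec (∃ P)
anyGR? {P} P? =
  map′ (λ { (a , b , p) → ((a , b) , p) }) (λ { ((a , b) , p) → (a , b , p) })
       (any? (λ a → any? (λ b → P? (a , b))))

incident? : ∀ v L → Dec (Incident v L)
incident? v (v₁ , v₂) = anyGR? (λ a → anyGR? (λ b → (a • v₁ ⊕V b • v₂) ≟V v))

-- Number of points of the set 𝔨 (given as a duplicate-free list of
-- point representatives) lying on the line L.
meet : List V → V × V → ℕ
meet ks L = length (filter (λ v → incident? v L) ks)

IsPointSet : ℕ → List V → Set
IsPointSet n ks = length ks ≡ n × All IsPointRep ks × AllPairs (λ v w → ¬ SamePoint v w) ks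

IsArc : ℕ → ℕ → List V → Set
IsArc n u ks =
  IsPointSet n ks
  × (∃[ L ] (IsLineRep L × meet ks L ≡ u))
  × (∀ L → IsLineRep L → meet ks L ≤ u)

ExactlyLinesMeeting : ℕ → ℕ → List V → Set
ExactlyLinesMeeting m j ks =
  ∃[ Ls ] ( length Ls ≡ m
          × All IsLineRep Ls
          × AllPairs (λ L M → ¬ SameLine L M) Ls
          × All (λ L → meet ks L ≡ j) Ls
          × (∀ L → IsLineRep L → meet ks L ≡ j → Any (SameLine L) Ls))

module Submission where

-- The arc is given by 126 explicit representatives, normalized so that
-- the first unit coordinate is 1.  Since R = G16 is local with maximal
-- ideal 2R, two normalized vectors spanning the same point are equal, so
-- the points are distinct as soon as the vectors are.
--
-- Lines are handled by Gaussian elimination over R.  Invertible 2×2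
-- matrices preserve the span and the freeness of a pair of vectors, and
-- pivoting on units brings every free pair to one of three reduced row
-- echelon forms: z = αx + βy; y = αx + βz with β a non-unit; x = αy + βz
-- with α, β non-units.  These 336 canonical lines are pairwise distinct,
-- and a point is on one iff it satisfies its equation.  Hence the number
-- of points of the arc on any line is a count over 336 equations.
--
-- The remaining facts are finite computations, checked by evaluation: the
-- ring laws of R, the distinctness of the canonical lines, the
-- normalization of the arc, and the counts (at most 8 points of the arc on
-- a canonical line; 315 canonical lines with 8 points, 21 with none).

open import Defs
open import Data.Nat using (ℕ; _≤_; _≤?_)
import Data.Nat.Properties as ℕ
open import Data.Fin using (zero; suc; #_)
import Data.Fin.Properties as Fin
open import Data.Product using (_×_; _,_; ∃-syntax; proj₁; proj₂; uncurry)
open import Data.Product.Properties using (≡-dec)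
open import Data.Sum using (_⊎_; inj₁; inj₂)
open import Data.Empty using (⊥; ⊥-elim)
open import Data.List using (List; []; _∷_; length; filter; map; allFin; cartesianProduct; _++_)
open import Data.List.Properties using (filter-≐; length-map)
open import Data.List.Membership.Propositional using (_∈_)
open import Data.List.Membership.Propositional.Properties
  using (∈-allFin; ∈-cartesianProduct⁺; ∈-filter⁺; ∈-map⁺; ∈-++⁺ˡ; ∈-++⁺ʳ)
open import Data.List.Relation.Unary.All as All using (All; []; _∷_)
import Data.List.Relation.Unary.All.Properties as All
open import Data.List.Relation.Unary.Any as Any using (Any)
open import Data.List.Relation.Unary.AllPairs as AllPairs using (AllPairs; []; _∷_)
import Data.List.Relation.Unary.AllPairs.Properties as AllPairs
open import Relation.Nullary using (Dec; yes; no; ¬_)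
open import Relation.Nullary.Decidable using (map′; from-yes; ¬?; _×-dec_; _⊎-dec_; _→-dec_)
open import Relation.Binary.Definitions using (DecidableEquality)
open import Relation.Binary.PropositionalEquality
  using (_≡_; _≢_; refl; sym; trans; cong; cong₂; subst; module ≡-Reasoning)
open ≡-Reasoning

1R 2R : GR
1R = (suc zero , zero)
2R = (suc (suc zero) , zero)

neg : GR → GR
neg (a , b) = (-₄ a , -₄ b)

infix 4 _≟_
_≟_ : DecidableEquality GR
_≟_ = _≟R_

-- Quantification over the 16 elements of R is decidable; every identity
-- below marked "by exhaustion" is checked this way on all of R.
∀? : {P : GR → Set} → ((r : GR) → Dec (P r)) → Dec ((r : GR) → P r)
∀? P? = map′ (λ f r → f (proj₁ r) (proj₂ r)) (λ f a b → f (a , b))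
             (Fin.all? (λ a → Fin.all? (λ b → P? (a , b))))

⊕-comm : ∀ x y → x ⊕ y ≡ y ⊕ x
⊕-comm = from-yes (∀? λ x → ∀? λ y → x ⊕ y ≟ y ⊕ x)

⊕-assoc : ∀ x y z → (x ⊕ y) ⊕ z ≡ x ⊕ (y ⊕ z)
⊕-assoc = from-yes (∀? λ x → ∀? λ y → ∀? λ z → (x ⊕ y) ⊕ z ≟ x ⊕ (y ⊕ z))

⊗-assoc : ∀ x y z → (x ⊗ y) ⊗ z ≡ x ⊗ (y ⊗ z)
⊗-assoc = from-yes (∀? λ x → ∀? λ y → ∀? λ z → (x ⊗ y) ⊗ z ≟ x ⊗ (y ⊗ z))

⊗-comm : ∀ x y → x ⊗ y ≡ y ⊗ x
⊗-comm = from-yes (∀? λ x → ∀? λ y → x ⊗ y ≟ y ⊗ x)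

⊗-distribˡ : ∀ a x y → a ⊗ (x ⊕ y) ≡ a ⊗ x ⊕ a ⊗ y
⊗-distribˡ = from-yes (∀? λ a → ∀? λ x → ∀? λ y → a ⊗ (x ⊕ y) ≟ a ⊗ x ⊕ a ⊗ y)

⊗-distribʳ : ∀ a x y → (x ⊕ y) ⊗ a ≡ x ⊗ a ⊕ y ⊗ a
⊗-distribʳ = from-yes (∀? λ a → ∀? λ x → ∀? λ y → (x ⊕ y) ⊗ a ≟ x ⊗ a ⊕ y ⊗ a)

⊗-identityʳ : ∀ x → x ⊗ 1R ≡ x
⊗-identityʳ = from-yes (∀? λ x → x ⊗ 1R ≟ x)

1x+0y : ∀ x y → 1R ⊗ x ⊕ 0R ⊗ y ≡ x
1x+0y = from-yes (∀? λ x → ∀? λ y → 1R ⊗ x ⊕ 0R ⊗ y ≟ x)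

0x+1y : ∀ x y → 0R ⊗ x ⊕ 1R ⊗ y ≡ y
0x+1y = from-yes (∀? λ x → ∀? λ y → 0R ⊗ x ⊕ 1R ⊗ y ≟ y)

x1+y0 : ∀ x y → x ⊗ 1R ⊕ y ⊗ 0R ≡ x
x1+y0 = from-yes (∀? λ x → ∀? λ y → x ⊗ 1R ⊕ y ⊗ 0R ≟ x)

x0+y1 : ∀ x y → x ⊗ 0R ⊕ y ⊗ 1R ≡ y
x0+y1 = from-yes (∀? λ x → ∀? λ y → x ⊗ 0R ⊕ y ⊗ 1R ≟ y)

0x+0y : ∀ x y → 0R ⊗ x ⊕ 0R ⊗ y ≡ 0R
0x+0y = from-yes (∀? λ x → ∀? λ y → 0R ⊗ x ⊕ 0R ⊗ y ≟ 0R)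

⊕-interchange : ∀ a b c d → (a ⊕ b) ⊕ (c ⊕ d) ≡ (a ⊕ c) ⊕ (b ⊕ d)
⊕-interchange a b c d = begin
  (a ⊕ b) ⊕ (c ⊕ d)  ≡⟨ ⊕-assoc a b (c ⊕ d) ⟩
  a ⊕ (b ⊕ (c ⊕ d))  ≡⟨ cong (a ⊕_) (sym (⊕-assoc b c d)) ⟩
  a ⊕ ((b ⊕ c) ⊕ d)  ≡⟨ cong (λ t → a ⊕ (t ⊕ d)) (⊕-comm b c) ⟩
  a ⊕ ((c ⊕ b) ⊕ d)  ≡⟨ cong (a ⊕_) (⊕-assoc c b d) ⟩
  a ⊕ (c ⊕ (b ⊕ d))  ≡⟨ sym (⊕-assoc a c (b ⊕ d)) ⟩
  (a ⊕ c) ⊕ (b ⊕ d)  ∎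

-- Substituting one linear combination of s, t into another: the scalar
-- identity behind both composition of matrices and span transitivity.
lin : ∀ a b c d e f s t →
      a ⊗ (c ⊗ s ⊕ d ⊗ t) ⊕ b ⊗ (e ⊗ s ⊕ f ⊗ t) ≡ (a ⊗ c ⊕ b ⊗ e) ⊗ s ⊕ (a ⊗ d ⊕ b ⊗ f) ⊗ t
lin a b c d e f s t = begin
  a ⊗ (c ⊗ s ⊕ d ⊗ t) ⊕ b ⊗ (e ⊗ s ⊕ f ⊗ t)
    ≡⟨ cong₂ _⊕_ (expand a c s d t) (expand b e s f t) ⟩
  ((a ⊗ c) ⊗ s ⊕ (a ⊗ d) ⊗ t) ⊕ ((b ⊗ e) ⊗ s ⊕ (b ⊗ f) ⊗ t)
    ≡⟨ ⊕-interchange ((a ⊗ c) ⊗ s) ((a ⊗ d) ⊗ t) ((b ⊗ e) ⊗ s) ((b ⊗ f) ⊗ t) ⟩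
  ((a ⊗ c) ⊗ s ⊕ (b ⊗ e) ⊗ s) ⊕ ((a ⊗ d) ⊗ t ⊕ (b ⊗ f) ⊗ t)
    ≡⟨ sym (cong₂ _⊕_ (⊗-distribʳ s (a ⊗ c) (b ⊗ e)) (⊗-distribʳ t (a ⊗ d) (b ⊗ f))) ⟩
  (a ⊗ c ⊕ b ⊗ e) ⊗ s ⊕ (a ⊗ d ⊕ b ⊗ f) ⊗ t  ∎
  where
  expand : ∀ k p x q y → k ⊗ (p ⊗ x ⊕ q ⊗ y) ≡ (k ⊗ p) ⊗ x ⊕ (k ⊗ q) ⊗ y
  expand k p x q y = trans (⊗-distribˡ k (p ⊗ x) (q ⊗ y))
                           (sym (cong₂ _⊕_ (⊗-assoc k p x) (⊗-assoc k q y)))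

-- Units and non-units.  R is local: its non-units form the ideal 2R,
-- which is killed by 2.

IsUnit : GR → Set
IsUnit x = ∃[ u ] x ⊗ u ≡ 1R

isUnit? : ∀ x → Dec (IsUnit x)
isUnit? x = anyGR? (λ u → x ⊗ u ≟ 1R)

record NonUnit (x : GR) : Set where
  constructor nonUnit
  field isNotUnit : ¬ IsUnit x
open NonUnit public

nonUnit? : ∀ x → Dec (NonUnit x)
nonUnit? x = map′ nonUnit isNotUnit (¬? (isUnit? x))

nonUnit-⊗ : ∀ a {x} → NonUnit x → NonUnit (a ⊗ x)
nonUnit-⊗ a {x} (nonUnit nx) = nonUnit λ { (u , axu) → nx (a ⊗ u , (begin
  x ⊗ (a ⊗ u)  ≡⟨ sym (⊗-assoc x a u) ⟩
  (x ⊗ a) ⊗ u  ≡⟨ cong (_⊗ u) (⊗-comm x a) ⟩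
  (a ⊗ x) ⊗ u  ≡⟨ axu ⟩
  1R           ∎)) }

nonUnit-⊕ : ∀ x y → NonUnit x → NonUnit y → NonUnit (x ⊕ y)
nonUnit-⊕ = from-yes (∀? λ x → ∀? λ y → nonUnit? x →-dec nonUnit? y →-dec nonUnit? (x ⊕ y))

nonUnit-comb : ∀ a b {x y} → NonUnit x → NonUnit y → NonUnit (a ⊗ x ⊕ b ⊗ y)
nonUnit-comb a b {x} {y} nx ny = nonUnit-⊕ (a ⊗ x) (b ⊗ y) (nonUnit-⊗ a nx) (nonUnit-⊗ b ny)

nonUnit-comb₀ : ∀ a {x} y → NonUnit x → NonUnit (a ⊗ x ⊕ 0R ⊗ y)
nonUnit-comb₀ a {x} y nx = subst NonUnit (sym (p+0q (a ⊗ x) y)) (nonUnit-⊗ a nx)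
  where
  p+0q : ∀ p q → p ⊕ 0R ⊗ q ≡ p
  p+0q = from-yes (∀? λ p → ∀? λ q → p ⊕ 0R ⊗ q ≟ p)

nonUnit-0 : NonUnit 0R
nonUnit-0 = from-yes (nonUnit? 0R)

2x+0y : ∀ x y → NonUnit x → 2R ⊗ x ⊕ 0R ⊗ y ≡ 0R
2x+0y = from-yes (∀? λ x → ∀? λ y → nonUnit? x →-dec 2R ⊗ x ⊕ 0R ⊗ y ≟ 0R)

vec≡ : ∀ {a a' b b' c c' : GR} → a ≡ a' → b ≡ b' → c ≡ c' → _≡_ {A = V} (a , b , c) (a' , b' , c')
vec≡ refl refl refl = refl

comb-comb : ∀ a b c d e f v w →
            a • (c • v ⊕V d • w) ⊕V b • (e • v ⊕V f • w) ≡ (a ⊗ c ⊕ b ⊗ e) • v ⊕V (a ⊗ d ⊕ b ⊗ f) • w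
comb-comb a b c d e f (v₁ , v₂ , v₃) (w₁ , w₂ , w₃) =
  vec≡ (lin a b c d e f v₁ w₁) (lin a b c d e f v₂ w₂) (lin a b c d e f v₃ w₃)

span-trans : ∀ {x v w s t} → InSpan2 x v w → InSpan2 v s t → InSpan2 w s t → InSpan2 x s t
span-trans {s = s} {t} (a , b , refl) (c , d , refl) (e , f , refl) =
  a ⊗ c ⊕ b ⊗ e , a ⊗ d ⊕ b ⊗ f , sym (comb-comb a b c d e f s t)

∼-sym : ∀ {L M} → SameLine L M → SameLine M L
∼-sym (L⊆M , M⊆L) = M⊆L , L⊆M

∼-trans : ∀ {L M N} → SameLine L M → SameLine M N → SameLine L N
∼-trans ((m₁∈L , m₂∈L) , (l₁∈M , l₂∈M)) ((n₁∈M , n₂∈M) , (m₁∈N , m₂∈N)) =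
  (span-trans n₁∈M m₁∈L m₂∈L , span-trans n₂∈M m₁∈L m₂∈L) ,
  (span-trans l₁∈M m₁∈N m₂∈N , span-trans l₂∈M m₁∈N m₂∈N)

incident-∼ : ∀ {v L M} → SameLine L M → Incident v L → Incident v M
incident-∼ (_ , (l₁∈M , l₂∈M)) v∈L = span-trans v∈L l₁∈M l₂∈M

-- 2×2 matrices over R act on pairs of vectors: (a , b , c , d) is the
-- matrix with rows (a b) and (c d), sending (v , w) to (a v + b w , c v + d w).

Pair : Set
Pair = V × V

Mat : Set
Mat = GR × GR × GR × GR

infix 4 _≟M_
_≟M_ : (A B : Mat) → Dec (A ≡ B)
_≟M_ = ≡-dec _≟R_ (≡-dec _≟R_ (≡-dec _≟R_ _≟R_))

1M : Mat
1M = (1R , 0R , 0R , 1R)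

infixl 7 _*_
_*_ : Mat → Mat → Mat
(a , b , c , d) * (e , f , g , h) = (a ⊗ e ⊕ b ⊗ g , a ⊗ f ⊕ b ⊗ h , c ⊗ e ⊕ d ⊗ g , c ⊗ f ⊕ d ⊗ h)

infixr 6 _·_
_·_ : Mat → Pair → Pair
(a , b , c , d) · (v , w) = (a • v ⊕V b • w , c • v ⊕V d • w)

Inverse : Mat → Mat → Set
Inverse A B = B * A ≡ 1M × A * B ≡ 1M

inverse? : ∀ A B → Dec (Inverse A B)
inverse? A B = (B * A ≟M 1M) ×-dec (A * B ≟M 1M)

·-assoc : ∀ A B L → (A * B) · L ≡ A · B · L
·-assoc (a , b , c , d) (e , f , g , h) (v , w) =
  sym (cong₂ _,_ (comb-comb a b e f g h v w) (comb-comb c d e f g h v w))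

·-identity : ∀ L → 1M · L ≡ L
·-identity ((v₁ , v₂ , v₃) , (w₁ , w₂ , w₃)) =
  cong₂ _,_ (vec≡ (1x+0y v₁ w₁) (1x+0y v₂ w₂) (1x+0y v₃ w₃))
            (vec≡ (0x+1y v₁ w₁) (0x+1y v₂ w₂) (0x+1y v₃ w₃))

basis-change-∼ : ∀ {A B} L → Inverse A B → SameLine L (A · L)
basis-change-∼ {A = A@(a , b , c , d)} {B = B@(e , f , g , h)} L (BA≡1 , _) =
  ((a , b , refl) , (c , d , refl)) , ((e , f , cong proj₁ back) , (g , h , cong proj₂ back))
  where
  back : B · A · L ≡ L
  back = trans (sym (·-assoc B A L)) (trans (cong (_· L) BA≡1) (·-identity L))

-- ... and preserves freeness: a relation x (A L)₁ + y (A L)₂ = 0 is the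
-- relation (x , y) A on L, hence (x , y) A = 0 and (x , y) = (x , y) A B = 0.
basis-change-free : ∀ {A B} L → Inverse A B → IsLineRep L → IsLineRep (A · L)
basis-change-free {A = a , b , c , d} {B = e , f , g , h} (v , w) (_ , AB≡1) ind x y rel =
  (begin
     x                                           ≡⟨ sym (x1+y0 x y) ⟩
     x ⊗ 1R ⊕ y ⊗ 0R                             ≡⟨ cong₂ (λ p q → x ⊗ p ⊕ y ⊗ q) (sym AB₁₁) (sym AB₂₁) ⟩
     x ⊗ (a ⊗ e ⊕ b ⊗ g) ⊕ y ⊗ (c ⊗ e ⊕ d ⊗ g)  ≡⟨ vanish e g ⟩
     0R                                          ∎) ,
  (begin
     y                                           ≡⟨ sym (x0+y1 x y) ⟩
     x ⊗ 0R ⊕ y ⊗ 1R                             ≡⟨ cong₂ (λ p q → x ⊗ p ⊕ y ⊗ q) (sym AB₁₂) (sym AB₂₂) ⟩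
     x ⊗ (a ⊗ f ⊕ b ⊗ h) ⊕ y ⊗ (c ⊗ f ⊕ d ⊗ h)  ≡⟨ vanish f h ⟩
     0R                                          ∎)
  where
  AB₁₁ = cong proj₁ AB≡1
  AB₁₂ = cong (λ M → proj₁ (proj₂ M)) AB≡1
  AB₂₁ = cong (λ M → proj₁ (proj₂ (proj₂ M))) AB≡1
  AB₂₂ = cong (λ M → proj₂ (proj₂ (proj₂ M))) AB≡1
  xA≡0 : (x ⊗ a ⊕ y ⊗ c ≡ 0R) × (x ⊗ b ⊕ y ⊗ d ≡ 0R)
  xA≡0 = ind (x ⊗ a ⊕ y ⊗ c) (x ⊗ b ⊕ y ⊗ d) (trans (sym (comb-comb x y a b c d v w)) rel)
  vanish : ∀ s t → x ⊗ (a ⊗ s ⊕ b ⊗ t) ⊕ y ⊗ (c ⊗ s ⊕ d ⊗ t) ≡ 0R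
  vanish s t = begin
    x ⊗ (a ⊗ s ⊕ b ⊗ t) ⊕ y ⊗ (c ⊗ s ⊕ d ⊗ t)  ≡⟨ lin x y a b c d s t ⟩
    (x ⊗ a ⊕ y ⊗ c) ⊗ s ⊕ (x ⊗ b ⊕ y ⊗ d) ⊗ t  ≡⟨ cong₂ (λ p q → p ⊗ s ⊕ q ⊗ t) (proj₁ xA≡0) (proj₂ xA≡0) ⟩
    0R ⊗ s ⊕ 0R ⊗ t                             ≡⟨ 0x+0y s t ⟩
    0R                                          ∎

-- A pair is free when its two vectors are linearly independent, i.e. when
-- it spans a line.  (A record, so that the pair is recovered by unification.)
record Free (L : Pair) : Set where
  constructor free
  field independent : IsLineRep L
open Free public

infix 4 _⇛_
record _⇛_ (L M : Pair) : Set where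
  constructor _,_
  field
    same      : SameLine L M
    keeps-free : Free L → Free M
open _⇛_ public

⇛-trans : ∀ {L M N} → L ⇛ M → M ⇛ N → L ⇛ N
⇛-trans (L∼M , freeM) (M∼N , freeN) = ∼-trans L∼M M∼N , λ fr → freeN (freeM fr)

⇛-≡ : ∀ {L M M'} → L ⇛ M → M ≡ M' → L ⇛ M'
⇛-≡ L⇛M refl = L⇛M

basis-change : ∀ {A B} L → Inverse A B → L ⇛ A · L
basis-change {A} {B} L inv =
  basis-change-∼ {A} {B} L inv , λ (free ind) → free (basis-change-free {A} {B} L inv ind)

swapM : Mat
swapM = (0R , 1R , 1R , 0R)

swap : ∀ {v w} → (v , w) ⇛ (w , v)
swap {v₁ , v₂ , v₃} {w₁ , w₂ , w₃} =
  ⇛-≡ (basis-change {swapM} {swapM} ((v₁ , v₂ , v₃) , (w₁ , w₂ , w₃)) (refl , refl))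
      (cong₂ _,_ (vec≡ (0x+1y v₁ w₁) (0x+1y v₂ w₂) (0x+1y v₃ w₃))
                 (vec≡ (1x+0y v₁ w₁) (1x+0y v₂ w₂) (1x+0y v₃ w₃)))

-- The pivot matrix (u 0 ; c 1) sends (v , w) to (u v , c v + w); when u is
-- a unit, with xu = 1, its inverse is (x 0 ; -cx 1) (by exhaustion).
pivotM : GR → GR → Mat
pivotM u c = (u , 0R , c , 1R)

pivotM-inverse : ∀ x u c → x ⊗ u ≡ 1R → Inverse (pivotM u c) (pivotM x (neg (c ⊗ x)))
pivotM-inverse = from-yes (∀? λ x → ∀? λ u → ∀? λ c →
  x ⊗ u ≟ 1R →-dec inverse? (pivotM u c) (pivotM x (neg (c ⊗ x))))

pivot : ∀ {x u} c L → x ⊗ u ≡ 1R → L ⇛ pivotM u c · L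
pivot {x} {u} c L xu = basis-change {pivotM u c} {pivotM x (neg (c ⊗ x))} L (pivotM-inverse x u c xu)

pivot-second : ∀ {x u v w r s} c → x ⊗ u ≡ 1R → pivotM u c · (w , v) ≡ (s , r) → (v , w) ⇛ (r , s)
pivot-second {x} {u} {v} {w} c xu eq = ⇛-trans swap (⇛-trans (⇛-≡ (pivot {x} {u} c (w , v) xu) eq) swap)

pivot-column : ∀ x u y → x ⊗ u ≡ 1R → (u ⊗ x ⊕ 0R ⊗ y ≡ 1R) × (neg (y ⊗ u) ⊗ x ⊕ 1R ⊗ y ≡ 0R)
pivot-column = from-yes (∀? λ x → ∀? λ u → ∀? λ y → x ⊗ u ≟ 1R →-dec
  (u ⊗ x ⊕ 0R ⊗ y ≟ 1R) ×-dec (neg (y ⊗ u) ⊗ x ⊕ 1R ⊗ y ≟ 0R))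

cleared-column : ∀ u c → (u ⊗ 0R ⊕ 0R ⊗ 1R ≡ 0R) × (c ⊗ 0R ⊕ 1R ⊗ 1R ≡ 1R)
cleared-column = from-yes (∀? λ u → ∀? λ c → (u ⊗ 0R ⊕ 0R ⊗ 1R ≟ 0R) ×-dec (c ⊗ 0R ⊕ 1R ⊗ 1R ≟ 1R))

-- A free pair has a unit entry in each of its two vectors: otherwise 2
-- would kill that vector.
unit-in-first : ∀ {x y z w} → Free ((x , y , z) , w) → NonUnit x → NonUnit y → NonUnit z → ⊥
unit-in-first {x} {y} {z} {w₁ , w₂ , w₃} (free ind) nx ny nz =
  2≢0 (proj₁ (ind 2R 0R (vec≡ (2x+0y x w₁ nx) (2x+0y y w₂ ny) (2x+0y z w₃ nz))))
  where
  2≢0 : ¬ 2R ≡ 0R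
  2≢0 ()

unit-in-second : ∀ {v x y z} → Free (v , (x , y , z)) → NonUnit x → NonUnit y → NonUnit z → ⊥
unit-in-second fr = unit-in-first (keeps-free swap fr)

data Form : Set where
  zForm yForm xForm : GR → GR → Form

gens : Form → Pair
gens (zForm α β) = ((1R , 0R , α) , (0R , 1R , β))
gens (yForm α β) = ((1R , α , 0R) , (0R , β , 1R))
gens (xForm α β) = ((α , 1R , 0R) , (β , 0R , 1R))

-- Pivots sit in the leftmost possible columns: every line has exactly one
-- canonical form (uniqueness is checked on the list of all of them below).
data Canonical : Form → Set where
  zC : ∀ {α β} → Canonical (zForm α β)
  yC : ∀ {α β} → NonUnit β → Canonical (yForm α β)
  xC : ∀ {α β} → NonUnit α → NonUnit β → Canonical (xForm α β)

data Echelon : Pair → Set where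
  pivot₁ : ∀ {b d y z} → Echelon ((1R , b , d) , (0R , y , z))
  pivot₂ : ∀ {a d x z} → NonUnit a → NonUnit x → Echelon ((a , 1R , d) , (x , 0R , z))

col₁ : ∀ {p p' q q' b d y z} → (p ≡ p') × (q ≡ q') → _≡_ {A = Pair} ((p , b , d) , (q , y , z)) ((p' , b , d) , (q' , y , z))
col₁ (refl , refl) = refl

col₂ : ∀ {p p' q q' a d x z} → (p ≡ p') × (q ≡ q') → _≡_ {A = Pair} ((a , p , d) , (x , q , z)) ((a , p' , d) , (x , q' , z))
col₂ (refl , refl) = refl

col₃ : ∀ {p p' q q' a b x y} → (p ≡ p') × (q ≡ q') → _≡_ {A = Pair} ((a , b , p) , (x , y , q)) ((a , b , p') , (x , y , q'))
col₃ (refl , refl) = refl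

EchelonOf : Pair → Set
EchelonOf L = ∃[ M ] (L ⇛ M × Echelon M)

pivot-col₁ : ∀ {x₁ y₁ z₁ x₂ y₂ z₂ u} → x₁ ⊗ u ≡ 1R → EchelonOf ((x₁ , y₁ , z₁) , (x₂ , y₂ , z₂))
pivot-col₁ {x₁} {y₁} {z₁} {x₂} {y₂} {z₂} {u} xu =
  _ , ⇛-≡ (pivot {x₁} {u} (neg (x₂ ⊗ u)) ((x₁ , y₁ , z₁) , (x₂ , y₂ , z₂)) xu)
          (col₁ (pivot-column x₁ u x₂ xu)) ,
  pivot₁

pivot-col₂ : ∀ {x₁ y₁ z₁ x₂ y₂ z₂ u} → NonUnit x₁ → NonUnit x₂ → y₁ ⊗ u ≡ 1R →
             EchelonOf ((x₁ , y₁ , z₁) , (x₂ , y₂ , z₂))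
pivot-col₂ {x₁} {y₁} {z₁} {x₂} {y₂} {z₂} {u} nx₁ nx₂ yu =
  _ , ⇛-≡ (pivot {y₁} {u} c ((x₁ , y₁ , z₁) , (x₂ , y₂ , z₂)) yu) (col₂ (pivot-column y₁ u y₂ yu)) ,
  pivot₂ (nonUnit-comb u 0R {x₁} {x₂} nx₁ nx₂) (nonUnit-comb c 1R {x₁} {x₂} nx₁ nx₂)
  where c = neg (y₂ ⊗ u)

no-pivot-col₃ : ∀ {x₁ y₁ z₁ x₂ y₂ z₂ u} → Free ((x₁ , y₁ , z₁) , (x₂ , y₂ , z₂)) →
                NonUnit x₁ → NonUnit x₂ → NonUnit y₁ → NonUnit y₂ → z₁ ⊗ u ≡ 1R → ⊥
no-pivot-col₃ {x₁} {y₁} {z₁} {x₂} {y₂} {z₂} {u} fr nx₁ nx₂ ny₁ ny₂ zu =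
  unit-in-second (keeps-free step fr) (nonUnit-comb c 1R {x₁} {x₂} nx₁ nx₂) (nonUnit-comb c 1R {y₁} {y₂} ny₁ ny₂) nonUnit-0
  where
  c = neg (z₂ ⊗ u)
  step = ⇛-≡ (pivot {z₁} {u} c ((x₁ , y₁ , z₁) , (x₂ , y₂ , z₂)) zu) (col₃ (pivot-column z₁ u z₂ zu))

swapped : ∀ {v w} → EchelonOf (w , v) → EchelonOf (v , w)
swapped (M , wv⇛M , e) = M , ⇛-trans swap wv⇛M , e

-- First step of Gaussian elimination: pivot on the leftmost column that
-- contains a unit, taking as pivot row one whose entry there is a unit.
no-pivot-in-column₃ : ∀ {x₁ y₁ z₁ x₂ y₂ z₂} → Free ((x₁ , y₁ , z₁) , (x₂ , y₂ , z₂)) →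
          NonUnit x₁ → NonUnit x₂ → NonUnit y₁ → NonUnit y₂ → Dec (IsUnit z₁) → Dec (IsUnit z₂) → ⊥
no-pivot-in-column₃ fr nx₁ nx₂ ny₁ ny₂ (yes (u , zu)) _ = no-pivot-col₃ {u = u} fr nx₁ nx₂ ny₁ ny₂ zu
no-pivot-in-column₃ fr nx₁ nx₂ ny₁ ny₂ (no _) (yes (u , zu)) = no-pivot-col₃ {u = u} (keeps-free swap fr) nx₂ nx₁ ny₂ ny₁ zu
no-pivot-in-column₃ fr nx₁ nx₂ ny₁ ny₂ (no ¬z₁) (no _) = unit-in-first fr nx₁ ny₁ (nonUnit ¬z₁)

from-column₂ : ∀ {x₁ y₁ z₁ x₂ y₂ z₂} → Free ((x₁ , y₁ , z₁) , (x₂ , y₂ , z₂)) →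
          NonUnit x₁ → NonUnit x₂ → Dec (IsUnit y₁) → Dec (IsUnit y₂) →
          EchelonOf ((x₁ , y₁ , z₁) , (x₂ , y₂ , z₂))
from-column₂ fr nx₁ nx₂ (yes (u , yu)) _ = pivot-col₂ {u = u} nx₁ nx₂ yu
from-column₂ fr nx₁ nx₂ (no _) (yes (u , yu)) = swapped (pivot-col₂ {u = u} nx₂ nx₁ yu)
from-column₂ {z₁ = z₁} {z₂ = z₂} fr nx₁ nx₂ (no ¬y₁) (no ¬y₂) =
  ⊥-elim (no-pivot-in-column₃ fr nx₁ nx₂ (nonUnit ¬y₁) (nonUnit ¬y₂) (isUnit? z₁) (isUnit? z₂))

from-column₁ : ∀ {x₁ y₁ z₁ x₂ y₂ z₂} → Free ((x₁ , y₁ , z₁) , (x₂ , y₂ , z₂)) →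
          Dec (IsUnit x₁) → Dec (IsUnit x₂) → EchelonOf ((x₁ , y₁ , z₁) , (x₂ , y₂ , z₂))
from-column₁ fr (yes (u , xu)) _ = pivot-col₁ {u = u} xu
from-column₁ fr (no _) (yes (u , xu)) = swapped (pivot-col₁ {u = u} xu)
from-column₁ {y₁ = y₁} {y₂ = y₂} fr (no ¬x₁) (no ¬x₂) =
  from-column₂ fr (nonUnit ¬x₁) (nonUnit ¬x₂) (isUnit? y₁) (isUnit? y₂)

echelon : ∀ L → Free L → EchelonOf L
echelon ((x₁ , _) , (x₂ , _)) fr = from-column₁ fr (isUnit? x₁) (isUnit? x₂)

-- Second step: pivot on the leftmost unit of the second vector and clear
-- the entry above it.
reduce-pivot₁ : ∀ {b d y z} → Free ((1R , b , d) , (0R , y , z)) → Dec (IsUnit y) → Dec (IsUnit z) →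
                ∃[ F ] (Canonical F × ((1R , b , d) , (0R , y , z)) ⇛ gens F)
reduce-pivot₁ {b} {d} {y} {z} fr (yes (u , yu)) _ =
  zForm _ _ , zC ,
  pivot-second {y} {u} c yu (trans (col₁ (cleared-column u c)) (col₂ (pivot-column y u b yu)))
  where c = neg (b ⊗ u)
reduce-pivot₁ {b} {d} {y} {z} fr (no ¬y) (yes (u , zu)) =
  yForm _ _ , yC (nonUnit-comb₀ u {y} b (nonUnit ¬y)) ,
  pivot-second {z} {u} c zu (trans (col₁ (cleared-column u c)) (col₃ (pivot-column z u d zu)))
  where c = neg (d ⊗ u)
reduce-pivot₁ fr (no ¬y) (no ¬z) = ⊥-elim (unit-in-second fr nonUnit-0 (nonUnit ¬y) (nonUnit ¬z))

reduce-pivot₂ : ∀ {a d x z} → NonUnit a → NonUnit x → Free ((a , 1R , d) , (x , 0R , z)) → Dec (IsUnit z) →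
                ∃[ F ] (Canonical F × ((a , 1R , d) , (x , 0R , z)) ⇛ gens F)
reduce-pivot₂ {a} {d} {x} {z} na nx fr (yes (u , zu)) =
  xForm _ _ , xC (nonUnit-comb c 1R {x} {a} nx na) (nonUnit-comb u 0R {x} {a} nx na) ,
  pivot-second {z} {u} c zu (trans (col₂ (cleared-column u c)) (col₃ (pivot-column z u d zu)))
  where c = neg (d ⊗ u)
reduce-pivot₂ na nx fr (no ¬z) = ⊥-elim (unit-in-second fr nx nonUnit-0 (nonUnit ¬z))

canonical-form : ∀ {M} → Echelon M → Free M → ∃[ F ] (Canonical F × M ⇛ gens F)
canonical-form (pivot₁ {y = y} {z}) fr = reduce-pivot₁ fr (isUnit? y) (isUnit? z)
canonical-form (pivot₂ {z = z} na nx) fr = reduce-pivot₂ na nx fr (isUnit? z)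

row-reduce : ∀ L → IsLineRep L → ∃[ F ] (Canonical F × SameLine L (gens F))
row-reduce L ind =
  let (M , L⇛M , e) = echelon L (free ind)
      (F , can , M⇛F) = canonical-form e (keeps-free L⇛M (free ind))
  in  F , can , ∼-trans (same L⇛M) (same M⇛F)

OnForm : Form → V → Set
OnForm (zForm α β) (x , y , z) = z ≡ x ⊗ α ⊕ y ⊗ β
OnForm (yForm α β) (x , y , z) = y ≡ x ⊗ α ⊕ z ⊗ β
OnForm (xForm α β) (x , y , z) = x ≡ y ⊗ α ⊕ z ⊗ β

onForm? : ∀ F v → Dec (OnForm F v)
onForm? (zForm α β) (x , y , z) = z ≟ x ⊗ α ⊕ y ⊗ β
onForm? (yForm α β) (x , y , z) = y ≟ x ⊗ α ⊕ z ⊗ β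
onForm? (xForm α β) (x , y , z) = x ≟ y ⊗ α ⊕ z ⊗ β

-- A point lies on a canonical line iff it satisfies its equation: the
-- coefficients of a v + b w are read off in the two pivot columns.
onForm→ : ∀ F v → Incident v (gens F) → OnForm F v
onForm→ (zForm α β) _ (a , b , refl) = cong₂ (λ p q → p ⊗ α ⊕ q ⊗ β) (sym (x1+y0 a b)) (sym (x0+y1 a b))
onForm→ (yForm α β) _ (a , b , refl) = cong₂ (λ p q → p ⊗ α ⊕ q ⊗ β) (sym (x1+y0 a b)) (sym (x0+y1 a b))
onForm→ (xForm α β) _ (a , b , refl) = cong₂ (λ p q → p ⊗ α ⊕ q ⊗ β) (sym (x1+y0 a b)) (sym (x0+y1 a b))

onForm← : ∀ F v → OnForm F v → Incident v (gens F)
onForm← (zForm α β) (x , y , z) eq = x , y , vec≡ (x1+y0 x y) (x0+y1 x y) (sym eq)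
onForm← (yForm α β) (x , y , z) eq = x , z , vec≡ (x1+y0 x z) (sym eq) (x0+y1 x z)
onForm← (xForm α β) (x , y , z) eq = y , z , vec≡ (sym eq) (x1+y0 y z) (x0+y1 y z)

-- Canonical generators are free: again read off the pivot columns.
gens-free : ∀ F → IsLineRep (gens F)
gens-free (zForm α β) a b rel = trans (sym (x1+y0 a b)) (cong proj₁ rel) ,
                                 trans (sym (x0+y1 a b)) (cong (λ v → proj₁ (proj₂ v)) rel)
gens-free (yForm α β) a b rel = trans (sym (x1+y0 a b)) (cong proj₁ rel) ,
                                 trans (sym (x0+y1 a b)) (cong (λ v → proj₂ (proj₂ v)) rel)
gens-free (xForm α β) a b rel = trans (sym (x1+y0 a b)) (cong (λ v → proj₁ (proj₂ v)) rel) ,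
                                 trans (sym (x0+y1 a b)) (cong (λ v → proj₂ (proj₂ v)) rel)

count : List V → Form → ℕ
count xs F = length (filter (onForm? F) xs)

meet-count : ∀ xs F → meet xs (gens F) ≡ count xs F
meet-count xs F = cong length (filter-≐ (λ v → incident? v (gens F)) (onForm? F)
                                        ((λ {v} → onForm→ F v) , (λ {v} → onForm← F v)) xs)

meet-∼ : ∀ xs {L M} → SameLine L M → meet xs L ≡ meet xs M
meet-∼ xs {L} {M} L∼M = cong length (filter-≐ (λ v → incident? v L) (λ v → incident? v M)
                                             (incident-∼ L∼M , incident-∼ (∼-sym L∼M)) xs)

allGR : List GR
allGR = cartesianProduct (allFin 4) (allFin 4)

nonUnits : List GR
nonUnits = filter nonUnit? allGR

canonicalLines : List Form
canonicalLines = map (uncurry zForm) (cartesianProduct allGR allGR)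
              ++ map (uncurry yForm) (cartesianProduct allGR nonUnits)
              ++ map (uncurry xForm) (cartesianProduct nonUnits nonUnits)

∈-allGR : ∀ x → x ∈ allGR
∈-allGR (a , b) = ∈-cartesianProduct⁺ (∈-allFin a) (∈-allFin b)

∈-nonUnits : ∀ {x} → NonUnit x → x ∈ nonUnits
∈-nonUnits {x} nx = ∈-filter⁺ nonUnit? (∈-allGR x) nx

canonical-∈ : ∀ {F} → Canonical F → F ∈ canonicalLines
canonical-∈ (zC {α} {β}) =
  ∈-++⁺ˡ (∈-map⁺ (uncurry zForm) (∈-cartesianProduct⁺ (∈-allGR α) (∈-allGR β)))
canonical-∈ (yC {α} nβ) = ∈-++⁺ʳ (map (uncurry zForm) (cartesianProduct allGR allGR))
  (∈-++⁺ˡ (∈-map⁺ (uncurry yForm) (∈-cartesianProduct⁺ (∈-allGR α) (∈-nonUnits nβ))))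
canonical-∈ (xC nα nβ) = ∈-++⁺ʳ (map (uncurry zForm) (cartesianProduct allGR allGR))
  (∈-++⁺ʳ (map (uncurry yForm) (cartesianProduct allGR nonUnits))
    (∈-map⁺ (uncurry xForm) (∈-cartesianProduct⁺ (∈-nonUnits nα) (∈-nonUnits nβ))))

Separated : Form → Form → Set
Separated F G = ¬ OnForm F (proj₁ (gens G)) ⊎ ¬ OnForm F (proj₂ (gens G))

separated? : ∀ F G → Dec (Separated F G)
separated? F G = ¬? (onForm? F _) ⊎-dec ¬? (onForm? F _)

separated⇒distinct : ∀ F G → Separated F G → ¬ SameLine (gens F) (gens G)
separated⇒distinct F G (inj₁ off) ((g₁∈F , _) , _) = off (onForm→ F _ g₁∈F)
separated⇒distinct F G (inj₂ off) ((_ , g₂∈F) , _) = off (onForm→ F _ g₂∈F)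

-- by exhaustion over the 336 · 335 / 2 pairs: the canonical lines are
-- pairwise distinct, so every line has exactly one canonical form.
canonical-separated : AllPairs Separated canonicalLines
canonical-separated = from-yes (AllPairs.allPairs? separated? canonicalLines)

module _ (xs : List V) (j : ℕ) where

  meets? : ∀ F → Dec (count xs F ≡ j)
  meets? F = count xs F ℕ.≟ j

  Meeting : List Form
  Meeting = filter meets? canonicalLines

  meeting-free : All IsLineRep (map gens Meeting)
  meeting-free = All.map⁺ {P = IsLineRep} {f = gens}
    (All.universal {P = λ F → IsLineRep (gens F)} gens-free Meeting)

  meeting-distinct : AllPairs (λ L M → ¬ SameLine L M) (map gens Meeting)
  meeting-distinct = AllPairs.map⁺ {R = λ L M → ¬ SameLine L M} {f = gens}
    (AllPairs.map {R = Separated} {S = λ F G → ¬ SameLine (gens F) (gens G)}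
                  (λ {F} {G} → separated⇒distinct F G)
                  (AllPairs.filter⁺ meets? canonical-separated))

  meeting-meets : All (λ L → meet xs L ≡ j) (map gens Meeting)
  meeting-meets = All.map⁺ {P = λ L → meet xs L ≡ j} {f = gens}
    (All.map {P = λ F → count xs F ≡ j} {Q = λ F → meet xs (gens F) ≡ j}
             (λ {F} c → trans (meet-count xs F) c) (All.all-filter meets? canonicalLines))

  meeting-complete : ∀ L → IsLineRep L → meet xs L ≡ j → Any (SameLine L) (map gens Meeting)
  meeting-complete L ind meets =
    let (F , can , L∼F) = row-reduce L ind
        F∈ = ∈-filter⁺ meets? (canonical-∈ can) (trans (sym (meet-count xs F)) (trans (sym (meet-∼ xs {L} {gens F} L∼F)) meets))
    in  Any.map {P = gens F ≡_} {Q = SameLine L} (λ { refl → L∼F }) (∈-map⁺ gens F∈)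

  linesMeeting : ExactlyLinesMeeting (length Meeting) j xs
  linesMeeting = map gens Meeting , length-map gens Meeting , meeting-free , meeting-distinct ,
                 meeting-meets , meeting-complete

maxMeet : ∀ xs n → All (λ F → count xs F ≤ n) canonicalLines → ∀ L → IsLineRep L → meet xs L ≤ n
maxMeet xs n bounded L ind =
  let (F , can , L∼F) = row-reduce L ind
  in  subst (_≤ n) (sym (trans (meet-∼ xs {L} {gens F} L∼F) (meet-count xs F))) (All.lookup bounded (canonical-∈ can))

data Normalized : V → Set where
  lead₁ : ∀ {y z} → Normalized (1R , y , z)
  lead₂ : ∀ {x z} → NonUnit x → Normalized (x , 1R , z)
  lead₃ : ∀ {x y} → NonUnit x → NonUnit y → Normalized (x , y , 1R)

normalized-by : ∀ {x y z} → Dec (x ≡ 1R) → Dec (NonUnit x) → Dec (y ≡ 1R) → Dec (NonUnit y) → Dec (z ≡ 1R) →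
                Dec (Normalized (x , y , z))
normalized-by (yes refl) _ _ _ _ = yes lead₁
normalized-by (no x≢1) (yes nx) (yes refl) _ _ = yes (lead₂ nx)
normalized-by (no x≢1) (yes nx) (no y≢1) (yes ny) (yes refl) = yes (lead₃ nx ny)
normalized-by (no x≢1) (no ¬nx) _ _ _ =
  no λ { lead₁ → x≢1 refl ; (lead₂ nx) → ¬nx nx ; (lead₃ nx _) → ¬nx nx }
normalized-by (no x≢1) (yes _) (no y≢1) (no ¬ny) _ =
  no λ { lead₁ → x≢1 refl ; (lead₂ _) → y≢1 refl ; (lead₃ _ ny) → ¬ny ny }
normalized-by (no x≢1) (yes _) (no y≢1) (yes _) (no z≢1) =
  no λ { lead₁ → x≢1 refl ; (lead₂ _) → y≢1 refl ; (lead₃ _ _) → z≢1 refl }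

normalized? : ∀ v → Dec (Normalized v)
normalized? (x , y , z) = normalized-by (x ≟ 1R) (nonUnit? x) (y ≟ 1R) (nonUnit? y) (z ≟ 1R)

normalized-point : ∀ {v} → Normalized v → IsPointRep v
normalized-point lead₁ a av≡0 = trans (sym (⊗-identityʳ a)) (cong proj₁ av≡0)
normalized-point (lead₂ _) a av≡0 = trans (sym (⊗-identityʳ a)) (cong (λ v → proj₁ (proj₂ v)) av≡0)
normalized-point (lead₃ _ _) a av≡0 = trans (sym (⊗-identityʳ a)) (cong (λ v → proj₂ (proj₂ v)) av≡0)

-- Two normalized vectors spanning the same point are equal: a coordinate 1
-- of one is a unit multiple of the same coordinate of the other, so the
-- leading coordinates agree, and the scalar is then 1.
multiple-of-nonUnit : ∀ a x → a ⊗ x ≡ 1R → NonUnit x → ⊥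
multiple-of-nonUnit a x ax≡1 nx = isNotUnit (nonUnit-⊗ a nx) (1R , trans (⊗-identityʳ (a ⊗ x)) ax≡1)

scaled-by-one : ∀ a {v} w → a ⊗ 1R ≡ 1R → a • w ≡ v → v ≡ w
scaled-by-one a {v} w@(w₁ , w₂ , w₃) a1≡1 aw≡v = begin
  v       ≡⟨ sym aw≡v ⟩
  a • w   ≡⟨ cong (_• w) (trans (sym (⊗-identityʳ a)) a1≡1) ⟩
  1R • w  ≡⟨ vec≡ (⊗-identityˡ w₁) (⊗-identityˡ w₂) (⊗-identityˡ w₃) ⟩
  w       ∎
  where
  ⊗-identityˡ : ∀ x → 1R ⊗ x ≡ x
  ⊗-identityˡ x = trans (⊗-comm 1R x) (⊗-identityʳ x)

normalized-unique : ∀ {v w} → Normalized v → Normalized w → SamePoint v w → v ≡ w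
normalized-unique {w = w} lead₁ lead₁ ((a , aw≡v) , _) = scaled-by-one a w (cong proj₁ aw≡v) aw≡v
normalized-unique {w = w₁ , _} lead₁ (lead₂ nw₁) ((a , aw≡v) , _) =
  ⊥-elim (multiple-of-nonUnit a w₁ (cong proj₁ aw≡v) nw₁)
normalized-unique {w = w₁ , _} lead₁ (lead₃ nw₁ _) ((a , aw≡v) , _) =
  ⊥-elim (multiple-of-nonUnit a w₁ (cong proj₁ aw≡v) nw₁)
normalized-unique {v = v₁ , _} (lead₂ nv₁) lead₁ (_ , (b , bv≡w)) =
  ⊥-elim (multiple-of-nonUnit b v₁ (cong proj₁ bv≡w) nv₁)
normalized-unique {w = w} (lead₂ _) (lead₂ _) ((a , aw≡v) , _) =
  scaled-by-one a w (cong (λ u → proj₁ (proj₂ u)) aw≡v) aw≡v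
normalized-unique {w = _ , w₂ , _} (lead₂ _) (lead₃ _ nw₂) ((a , aw≡v) , _) =
  ⊥-elim (multiple-of-nonUnit a w₂ (cong (λ u → proj₁ (proj₂ u)) aw≡v) nw₂)
normalized-unique {v = v₁ , _} (lead₃ nv₁ _) lead₁ (_ , (b , bv≡w)) =
  ⊥-elim (multiple-of-nonUnit b v₁ (cong proj₁ bv≡w) nv₁)
normalized-unique {v = _ , v₂ , _} (lead₃ _ nv₂) (lead₂ _) (_ , (b , bv≡w)) =
  ⊥-elim (multiple-of-nonUnit b v₂ (cong (λ u → proj₁ (proj₂ u)) bv≡w) nv₂)
normalized-unique {w = w} (lead₃ _ _) (lead₃ _ _) ((a , aw≡v) , _) =
  scaled-by-one a w (cong (λ u → proj₂ (proj₂ u)) aw≡v) aw≡v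

distinct-points : ∀ {xs} → All Normalized xs → AllPairs _≢_ xs → AllPairs (λ v w → ¬ SamePoint v w) xs
distinct-points [] [] = []
distinct-points (nv ∷ nvs) (v≢ ∷ v≢s) =
  All.zipWith (λ (nw , v≢w) same → v≢w (normalized-unique nv nw same)) (nvs , v≢) ∷ distinct-points nvs v≢s

-- gᵢⱼ is the element i + jX of R.
g00 g01 g02 g03 g10 g11 g12 g13 g20 g21 g22 g23 g30 g31 g32 g33 : GR
g00 = # 0 , # 0
g01 = # 0 , # 1
g02 = # 0 , # 2
g03 = # 0 , # 3
g10 = # 1 , # 0
g11 = # 1 , # 1
g12 = # 1 , # 2
g13 = # 1 , # 3
g20 = # 2 , # 0
g21 = # 2 , # 1
g22 = # 2 , # 2
g23 = # 2 , # 3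
g30 = # 3 , # 0
g31 = # 3 , # 1
g32 = # 3 , # 2
g33 = # 3 , # 3

arc : List V
arc =
  (g00 , g00 , g10) ∷ (g00 , g02 , g10) ∷ (g00 , g10 , g02) ∷ (g00 , g10 , g03) ∷ (g00 , g10 , g12) ∷ (g00 , g10 , g20) ∷
  (g00 , g10 , g23) ∷ (g00 , g10 , g32) ∷ (g02 , g00 , g10) ∷ (g02 , g10 , g01) ∷ (g02 , g10 , g10) ∷ (g02 , g10 , g12) ∷
  (g02 , g10 , g13) ∷ (g02 , g10 , g23) ∷ (g02 , g10 , g33) ∷ (g02 , g20 , g10) ∷ (g10 , g00 , g01) ∷ (g10 , g00 , g10) ∷
  (g10 , g00 , g11) ∷ (g10 , g00 , g12) ∷ (g10 , g00 , g23) ∷ (g10 , g00 , g31) ∷ (g10 , g01 , g01) ∷ (g10 , g01 , g02) ∷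
  (g10 , g01 , g11) ∷ (g10 , g01 , g20) ∷ (g10 , g01 , g21) ∷ (g10 , g01 , g31) ∷ (g10 , g02 , g00) ∷ (g10 , g02 , g01) ∷
  (g10 , g02 , g10) ∷ (g10 , g02 , g21) ∷ (g10 , g02 , g22) ∷ (g10 , g02 , g30) ∷ (g10 , g03 , g02) ∷ (g10 , g03 , g03) ∷
  (g10 , g03 , g10) ∷ (g10 , g03 , g12) ∷ (g10 , g03 , g21) ∷ (g10 , g03 , g22) ∷ (g10 , g10 , g00) ∷ (g10 , g10 , g10) ∷
  (g10 , g10 , g11) ∷ (g10 , g10 , g12) ∷ (g10 , g10 , g22) ∷ (g10 , g10 , g33) ∷ (g10 , g11 , g03) ∷ (g10 , g11 , g11) ∷
  (g10 , g11 , g12) ∷ (g10 , g11 , g21) ∷ (g10 , g11 , g30) ∷ (g10 , g11 , g31) ∷ (g10 , g12 , g03) ∷ (g10 , g12 , g10) ∷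
  (g10 , g12 , g11) ∷ (g10 , g12 , g23) ∷ (g10 , g12 , g30) ∷ (g10 , g12 , g31) ∷ (g10 , g13 , g00) ∷ (g10 , g13 , g03) ∷
  (g10 , g13 , g10) ∷ (g10 , g13 , g12) ∷ (g10 , g13 , g20) ∷ (g10 , g13 , g23) ∷ (g10 , g20 , g02) ∷ (g10 , g20 , g11) ∷
  (g10 , g20 , g12) ∷ (g10 , g20 , g22) ∷ (g10 , g20 , g30) ∷ (g10 , g20 , g33) ∷ (g10 , g21 , g01) ∷ (g10 , g21 , g03) ∷
  (g10 , g21 , g11) ∷ (g10 , g21 , g12) ∷ (g10 , g21 , g30) ∷ (g10 , g21 , g33) ∷ (g10 , g22 , g00) ∷ (g10 , g22 , g02) ∷
  (g10 , g22 , g21) ∷ (g10 , g22 , g23) ∷ (g10 , g22 , g31) ∷ (g10 , g22 , g33) ∷ (g10 , g23 , g10) ∷ (g10 , g23 , g20) ∷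
  (g10 , g23 , g22) ∷ (g10 , g23 , g30) ∷ (g10 , g23 , g31) ∷ (g10 , g23 , g33) ∷ (g10 , g30 , g01) ∷ (g10 , g30 , g03) ∷
  (g10 , g30 , g12) ∷ (g10 , g30 , g20) ∷ (g10 , g30 , g22) ∷ (g10 , g30 , g30) ∷ (g10 , g31 , g00) ∷ (g10 , g31 , g02) ∷
  (g10 , g31 , g10) ∷ (g10 , g31 , g11) ∷ (g10 , g31 , g30) ∷ (g10 , g31 , g33) ∷ (g10 , g32 , g00) ∷ (g10 , g32 , g01) ∷
  (g10 , g32 , g20) ∷ (g10 , g32 , g23) ∷ (g10 , g32 , g31) ∷ (g10 , g32 , g33) ∷ (g10 , g33 , g02) ∷ (g10 , g33 , g20) ∷
  (g10 , g33 , g21) ∷ (g10 , g33 , g23) ∷ (g10 , g33 , g31) ∷ (g10 , g33 , g33) ∷ (g20 , g02 , g10) ∷ (g20 , g10 , g00) ∷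
  (g20 , g10 , g01) ∷ (g20 , g10 , g02) ∷ (g20 , g10 , g03) ∷ (g20 , g10 , g11) ∷ (g20 , g10 , g13) ∷ (g20 , g20 , g10) ∷
  (g22 , g10 , g00) ∷ (g22 , g10 , g10) ∷ (g22 , g10 , g11) ∷ (g22 , g10 , g20) ∷ (g22 , g10 , g32) ∷ (g22 , g10 , g33) ∷
  []

arc-normalized : All Normalized arc
arc-normalized = from-yes (All.all? normalized? arc)

arc-distinct : AllPairs _≢_ arc
arc-distinct = from-yes (AllPairs.allPairs? (λ v w → ¬? (v ≟V w)) arc)

arc-bounded : All (λ F → count arc F ≤ 8) canonicalLines
arc-bounded = from-yes (All.all? (λ F → count arc F ≤? 8) canonicalLines)

z=0-meets-arc : count arc (zForm 0R 0R) ≡ 8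
z=0-meets-arc = refl

lines-with-8 : length (Meeting arc 8) ≡ 315
lines-with-8 = refl

lines-with-0 : length (Meeting arc 0) ≡ 21
lines-with-0 = refl

mainTheorem3 : ∃[ ks ] (IsArc 126 8 ks × ExactlyLinesMeeting 315 8 ks × ExactlyLinesMeeting 21 0 ks)
mainTheorem3 =
  arc ,
  ( ( (refl , All.map normalized-point arc-normalized , distinct-points arc-normalized arc-distinct)
    , (gens (zForm 0R 0R) , gens-free (zForm 0R 0R) , trans (meet-count arc (zForm 0R 0R)) z=0-meets-arc)
    , maxMeet arc 8 arc-bounded )
  , subst (λ m → ExactlyLinesMeeting m 8 arc) lines-with-8 (linesMeeting arc 8)
  , subst (λ m → ExactlyLinesMeeting m 0 arc) lines-with-0 (linesMeeting arc 0) )
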